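{- Let $\{V_j\}_{j\ge1}$ be a sequence of positive integers with $V_j=V_{j-1}+V_{j-2}$ for all $j\ge3$, let $n\ge1$ be an integer and $d\ge2$ an even integer, and assume $\gcd(V_1,V_2)=\gcd(V_n,F_d)=1$. Let $S=\langle V_n,V_{n+d},V_{n+2d},\ldots\rangle$. Then the Apéry set of $S$ with respect to $V_n$ is \[ \mathrm{Ap}(S,V_n)=\{s(x):1\le x\le V_n-1\}\cup\{0\}. \]
   Context: $F_j$ is the $j$-th Fibonacci number ($F_0=0,F_1=F_2=1$); note $F_d\mid F_{jd}$ for all $j\ge1$. $\langle A\rangle$ is the set of finite non-negative integer linear combinations of elements of $A$. For $a\in S$, the Apéry set is $\mathrm{Ap}(S,a)=\{m\in S: m-a\notin S\}$. The function $s$ (depending on $V$, $n$, $d$) is defined for a positive integer $x$ as follows: let $k\ge1$ be the integer with $F_{kd}/F_d\le x<F_{(k+1)d}/F_d$; define greedily $\lambda_k=\lfloor x/(F_{kd}/F_d)\rfloor$ and, for $j=k-1,k-2,\ldots,1$, $\lambda_j=\left\lfloor \big(x-\sum_{i=j+1}^k\lambda_iF_{id}/F_d\big)/(F_{jd}/F_d)\right\rfloor$; then $s(x)=\sum_{i=1}^k\lambda_iV_{n+id}$. -}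

module Defs where

open import Data.Nat using (ℕ; zero; suc; _+_; _*_; _∸_; _≤_; _<_)
open import Data.Nat.DivMod using (_/_)
open import Data.List using (List; []; _∷_)
open import Data.Product using (∃; _×_)
open import Relation.Binary.PropositionalEquality using (_≡_)
open import Relation.Nullary using (¬_)

F : ℕ → ℕ
F zero = 0
F (suc zero) = 1
F (suc (suc j)) = F (suc j) + F j

-- natural-number floor division; division by 0 is set to 0
-- (never used under the hypotheses: F d ≥ 1 for d ≥ 2, and F(jd)/F d ≥ 1 for j ≥ 1)
divℕ : ℕ → ℕ → ℕ
divℕ m zero = 0
divℕ m (suc k) = m / suc k

G : ℕ → ℕ → ℕ
G d j = divℕ (F (j * d)) (F d)

combFrom : (ℕ → ℕ) → ℕ → ℕ → ℕ → List ℕ → ℕ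
combFrom V n d i [] = 0
combFrom V n d i (c ∷ cs) = c * V (n + i * d) + combFrom V n d (suc i) cs

InS : (ℕ → ℕ) → ℕ → ℕ → ℕ → Set
InS V n d m = ∃ λ (cs : List ℕ) → m ≡ combFrom V n d 0 cs

-- m ∈ Ap(S, a)  :  m ∈ S and m - a ∉ S (m - a negative counts as ∉ S)
InAp : (ℕ → ℕ) → ℕ → ℕ → ℕ → ℕ → Set
InAp V n d a m = InS V n d m × ¬ (a ≤ m × InS V n d (m ∸ a))

greedy : (ℕ → ℕ) → ℕ → ℕ → ℕ → ℕ → ℕ
greedy V n d r zero = 0
greedy V n d r (suc j) =
  divℕ r (G d (suc j)) * V (n + suc j * d)
  + greedy V n d (r ∸ divℕ r (G d (suc j)) * G d (suc j)) j

IsTopIndex : ℕ → ℕ → ℕ → Set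
IsTopIndex d x k = 1 ≤ k × G d k ≤ x × x < G d (suc k)

s : (ℕ → ℕ) → ℕ → ℕ → ℕ → ℕ → ℕ
s V n d x k = greedy V n d x k

{-# OPTIONS --safe #-}
module Submission where

open import Defs
open import Data.Empty using (⊥-elim)
open import Data.List using (List; []; _∷_; length; replicate; _++_)
open import Data.Nat
open import Data.Nat.Coprimality using (Coprime; gcd≡1⇒coprime; coprime-divisor)
open import Data.Nat.DivMod using (+-distrib-/-∣ʳ; m<n⇒m/n≡0; m*n/n≡m; m/n*n≤m; m%n<n; m≡m%n+[m/n]*n; n/1≡n)
open import Data.Nat.Divisibility using (_∣_; divides; ∣-trans; ∣⇒≤; ∣m+n∣m⇒∣n; n∣m*n; m∣m*n)
open import Data.Nat.GCD using (gcd)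
open import Data.Nat.Properties
open import Data.Nat.Tactic.RingSolver using (solve-∀)
open import Data.Product using (∃; ∃₂; _×_; _,_)
open import Data.Sum using (_⊎_; inj₁; inj₂)
open import Function.Bundles using (_⇔_; mk⇔)
open import Function.Properties.Equivalence using () renaming (trans to ⇔-trans)
open import Relation.Binary.PropositionalEquality
open import Relation.Nullary using (¬_; yes; no)

-- Let d be even, L = F_{d-1} + F_{d+1} the Lucas number and U the sequence U₀ = 0, U₁ = 1,
-- U_{j+2} + U_j = L U_{j+1}. Evenness of d (through Cassini, F_{d-1} F_{d+1} = F_d² + 1) makes
-- every Fibonacci-like Y satisfy Y_{t+2d} + Y_t = L Y_{t+d}; hence F_{jd}/F_d = U_j and
-- w_j = V_{n+jd} obeys w_j + V_n U_{j-1} = U_j V_{n+d}. Summing this over the greedy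
-- representation x = Σ λ_j U_j gives s(x) + V_n · lagged x = x V_{n+d}, where
-- lagged x = Σ λ_j U_{j-1}. The greedy representation maximises Σ c_j U_{j-1} among all
-- representations Σ c_j U_j of the same number, and lagged (z + t) ≤ lagged z + t; with
-- V_n ≤ V_{n+d} this turns any element Σ c_j w_j of S into s(x) + V_n t with x < V_n.
-- Finally gcd(V_n, V_{n+d}) = 1, so x is determined modulo V_n by the element, and
-- s(x) - V_n ∉ S.

FibonacciLike : (ℕ → ℕ) → Set
FibonacciLike Y = ∀ t → Y (suc (suc t)) ≡ Y (suc t) + Y t

fibonacciLike-shift : ∀ Y → FibonacciLike Y → ∀ c → FibonacciLike (λ t → Y (t + c))
fibonacciLike-shift Y rec c t = rec (t + c)

fibonacciLike-expand : ∀ Y → FibonacciLike Y → ∀ k → Y (suc k) ≡ F k * Y 0 + F (suc k) * Y 1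
fibonacciLike-expand Y rec zero = sym (+-identityʳ _)
fibonacciLike-expand Y rec (suc zero) = trans (rec 0) (swap (Y 0) (Y 1))
  where
    swap : ∀ y₀ y₁ → y₁ + y₀ ≡ 1 * y₀ + 1 * y₁
    swap = solve-∀
fibonacciLike-expand Y rec (suc (suc k)) = begin
    Y (3 + k)                                                      ≡⟨ rec (suc k) ⟩
    Y (2 + k) + Y (1 + k)                                          ≡⟨ cong₂ _+_ (fibonacciLike-expand Y rec (suc k))
                                                                                (fibonacciLike-expand Y rec k) ⟩
    (F (1 + k) * Y 0 + F (2 + k) * Y 1) + (F k * Y 0 + F (1 + k) * Y 1) ≡⟨ collect (F k) (F (suc k)) (Y 0) (Y 1) ⟩
    F (2 + k) * Y 0 + F (3 + k) * Y 1                              ∎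
  where
    open ≡-Reasoning
    collect : ∀ p q y₀ y₁ → (q * y₀ + (q + p) * y₁) + (p * y₀ + q * y₁) ≡ (q + p) * y₀ + ((q + p) + q) * y₁
    collect = solve-∀

fibonacciLike-coprime : ∀ Y → FibonacciLike Y → Coprime (Y 0) (Y 1) → ∀ j → Coprime (Y j) (Y (suc j))
fibonacciLike-coprime Y rec cop zero = cop
fibonacciLike-coprime Y rec cop (suc j) {i} (i∣Y₁₊ⱼ , i∣Y₂₊ⱼ) =
  fibonacciLike-coprime Y rec cop j (∣m+n∣m⇒∣n (subst (i ∣_) (rec j) i∣Y₂₊ⱼ) i∣Y₁₊ⱼ , i∣Y₁₊ⱼ)

F-suc-+ : ∀ e k → F (suc k + e) ≡ F k * F e + F (suc k) * F (suc e)
F-suc-+ e = fibonacciLike-expand (λ t → F (t + e)) (fibonacciLike-shift F (λ _ → refl) e)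

F-pos : ∀ j → 1 ≤ F (suc j)
F-pos zero = ≤-refl
F-pos (suc j) = ≤-trans (F-pos j) (m≤m+n (F (suc j)) (F j))

private
  cassini-step : ∀ n → F (1 + n) * F (3 + n) + F (2 + n) * F n ≡ F (2 + n) * F (2 + n) + F (1 + n) * F (1 + n)
  cassini-step n = identity (F n) (F (suc n))
    where
      identity : ∀ a b → b * ((b + a) + b) + (b + a) * a ≡ (b + a) * (b + a) + b * b
      identity = solve-∀

  trade-oneˡ : ∀ {a b c d} → a + b ≡ c + d → b ≡ d + 1 → a + 1 ≡ c
  trade-oneˡ {a} {d = d} eq refl = +-cancelʳ-≡ d _ _ (trans (+-assoc a 1 d) (trans (cong (a +_) (+-comm 1 d)) eq))

  trade-oneʳ : ∀ {a b c d} → a + b ≡ c + d → b + 1 ≡ d → a ≡ c + 1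
  trade-oneʳ {b = b} {c} eq refl = +-cancelʳ-≡ b _ _ (trans eq (trans (cong (c +_) (+-comm b 1)) (sym (+-assoc c 1 b))))

cassini-even : ∀ m → F (m * 2) * F (2 + m * 2) + 1 ≡ F (1 + m * 2) * F (1 + m * 2)
cassini-odd : ∀ m → F (1 + m * 2) * F (3 + m * 2) ≡ F (2 + m * 2) * F (2 + m * 2) + 1
cassini-even zero = refl
cassini-even (suc m) = trade-oneˡ
  (trans (cong (F (2 + k) * F (4 + k) +_) (*-comm (F (1 + k)) (F (3 + k)))) (cassini-step (1 + k)))
  (cassini-odd m)
  where k = m * 2
cassini-odd m = trade-oneʳ (cassini-step (m * 2))
  (trans (cong (_+ 1) (*-comm (F (2 + m * 2)) (F (m * 2)))) (cassini-even m))

lucas : ℕ → ℕ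
lucas zero = 2
lucas (suc d) = F d + F (suc (suc d))

lucas-doubling : ∀ Y → FibonacciLike Y → ∀ m → let d = 2 + m * 2 in Y (d + d) + Y 0 ≡ lucas d * Y d
lucas-doubling Y rec m = begin
    Y (d + d) + Y 0                                           ≡⟨ cong (_+ Y 0) (fibonacciLike-expand Y rec (d′ + d)) ⟩
    (F (d′ + d) * Y 0 + F (d + d) * Y 1) + Y 0                ≡⟨ cong₂ (λ p q → (p * Y 0 + q * Y 1) + Y 0) F-2d-1 F-2d ⟩
    ((F d′ * F d′ + F d * F d) * Y 0 + (F d′ * F d + F d * F (suc d)) * Y 1) + Y 0
                                                              ≡⟨ factor (F d′) (F d) (F (suc d)) (Y 0) (Y 1) (cassini-odd m) ⟩
    lucas d * (F d′ * Y 0 + F d * Y 1)                        ≡⟨ cong (lucas d *_) (sym (fibonacciLike-expand Y rec d′)) ⟩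
    lucas d * Y d                                             ∎
  where
    open ≡-Reasoning
    d′ = 1 + m * 2
    d = suc d′
    F-2d-1 : F (d′ + d) ≡ F d′ * F d′ + F d * F d
    F-2d-1 = trans (cong F (+-comm d′ d)) (F-suc-+ d′ d′)
    F-2d : F (d + d) ≡ F d′ * F d + F d * F (suc d)
    F-2d = F-suc-+ d d′
    factor : ∀ a b c y₀ y₁ → a * c ≡ b * b + 1
           → ((a * a + b * b) * y₀ + (a * b + b * c) * y₁) + y₀ ≡ (a + c) * (a * y₀ + b * y₁)
    factor a b c y₀ y₁ cassini = begin
      ((a * a + b * b) * y₀ + (a * b + b * c) * y₁) + y₀   ≡⟨ regroup a b c y₀ y₁ ⟩
      (a * a + (b * b + 1)) * y₀ + (a * b + b * c) * y₁    ≡⟨ cong (λ z → (a * a + z) * y₀ + (a * b + b * c) * y₁)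
                                                                    (sym cassini) ⟩
      (a * a + a * c) * y₀ + (a * b + b * c) * y₁          ≡⟨ distribute a b c y₀ y₁ ⟩
      (a + c) * (a * y₀ + b * y₁)                          ∎
      where
        regroup : ∀ a b c y₀ y₁ → ((a * a + b * b) * y₀ + (a * b + b * c) * y₁) + y₀
                                 ≡ (a * a + (b * b + 1)) * y₀ + (a * b + b * c) * y₁
        regroup = solve-∀
        distribute : ∀ a b c y₀ y₁ → (a * a + a * c) * y₀ + (a * b + b * c) * y₁ ≡ (a + c) * (a * y₀ + b * y₁)
        distribute = solve-∀

divℕ-*-≤ : ∀ r N → divℕ r N * N ≤ r
divℕ-*-≤ r zero = z≤n
divℕ-*-≤ r (suc N) = m/n*n≤m r (suc N)

divℕ-+-* : ∀ {r N} q → r < N → divℕ (r + q * N) N ≡ q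
divℕ-+-* {r} {suc N} q r<N =
  trans (+-distrib-/-∣ʳ r (n∣m*n q)) (cong₂ _+_ (m<n⇒m/n≡0 r<N) (m*n/n≡m q (suc N)))

divMod-decomposition : ∀ {N} → 1 ≤ N → ∀ z → ∃₂ λ r q → r < N × z ≡ r + q * N
divMod-decomposition {suc N} _ z = z % suc N , z / suc N , m%n<n z (suc N) , m≡m%n+[m/n]*n z (suc N)

private
  ∣∧<⇒≡0 : ∀ {a δ} → a ∣ δ → δ < a → δ ≡ 0
  ∣∧<⇒≡0 {δ = zero}  _   _   = refl
  ∣∧<⇒≡0 {δ = suc _} a∣δ δ<a = ⊥-elim (<⇒≱ δ<a (∣⇒≤ a∣δ))

  coprime-cancel-≤ : ∀ {a W x x′ h h′} → Coprime a W → x ≤ x′ → x′ < a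
                   → x * W + a * h ≡ x′ * W + a * h′ → x ≡ x′
  coprime-cancel-≤ {a} {W} {x} {h = h} {h′} cop x≤x′ x′<a eq with m≤n⇒∃[o]m+o≡n x≤x′
  ... | δ , refl = sym (trans (cong (x +_) δ≡0) (+-identityʳ x))
    where
      spread : ∀ x δ W a h′ → (x + δ) * W + a * h′ ≡ x * W + (a * h′ + W * δ)
      spread = solve-∀
      a∣Wδ : a ∣ W * δ
      a∣Wδ = ∣m+n∣m⇒∣n (subst (a ∣_) (+-cancelˡ-≡ (x * W) _ _ (trans eq (spread x δ W a h′))) (m∣m*n h))
                       (m∣m*n h′)
      δ≡0 : δ ≡ 0
      δ≡0 = ∣∧<⇒≡0 (coprime-divisor cop a∣Wδ) (≤-trans (s≤s (m≤n+m δ x)) x′<a)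

coprime-cancel : ∀ {a W x x′ h h′} → Coprime a W → x < a → x′ < a
               → x * W + a * h ≡ x′ * W + a * h′ → x ≡ x′
coprime-cancel {x = x} {x′} cop x<a x′<a eq with ≤-total x x′
... | inj₁ x≤x′ = coprime-cancel-≤ cop x≤x′ x′<a eq
... | inj₂ x′≤x = sym (coprime-cancel-≤ cop x′≤x x<a (sym eq))

linear-step : ∀ a c {b x₁ x₂ x₃ s₁ s₂ s₃} → x₁ + a * x₂ ≡ x₃ * b → s₁ + a * s₂ ≡ s₃ * b
            → (c * x₁ + s₁) + a * (c * x₂ + s₂) ≡ (c * x₃ + s₃) * b
linear-step a c {b} {x₁} {x₂} {x₃} {s₁} {s₂} {s₃} x-eq s-eq = begin
    (c * x₁ + s₁) + a * (c * x₂ + s₂)  ≡⟨ regroup c x₁ s₁ a x₂ s₂ ⟩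
    c * (x₁ + a * x₂) + (s₁ + a * s₂)  ≡⟨ cong₂ (λ x s → c * x + s) x-eq s-eq ⟩
    c * (x₃ * b) + s₃ * b              ≡⟨ factor c x₃ b s₃ ⟩
    (c * x₃ + s₃) * b                  ∎
  where
    open ≡-Reasoning
    regroup : ∀ c x₁ s₁ a x₂ s₂ → (c * x₁ + s₁) + a * (c * x₂ + s₂) ≡ c * (x₁ + a * x₂) + (s₁ + a * s₂)
    regroup = solve-∀
    factor : ∀ c x b s → c * (x * b) + s * b ≡ (c * x + s) * b
    factor = solve-∀

comb : (ℕ → ℕ) → ℕ → List ℕ → ℕ
comb w i [] = 0
comb w i (c ∷ cs) = c * w i + comb w (suc i) cs

comb-linear : ∀ {w₁ w₂ w₃ a b} → (∀ i → w₁ (suc i) + a * w₂ (suc i) ≡ w₃ (suc i) * b)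
            → ∀ i cs → comb w₁ (suc i) cs + a * comb w₂ (suc i) cs ≡ comb w₃ (suc i) cs * b
comb-linear {a = a} rel i [] = *-zeroʳ a
comb-linear {w₁} {w₂} {w₃} {a} rel i (c ∷ cs) = linear-step a c (rel i) (comb-linear {w₁} {w₂} {w₃} {a} rel (suc i) cs)

apery-from-normal-form : ∀ {P : ℕ → Set} {a} (r : ℕ → ℕ)
  → (∀ {x} t → x < a → P (r x + a * t))
  → (∀ {m} → P m → ∃₂ λ x t → x < a × m ≡ r x + a * t)
  → (∀ {x x′ t} → x < a → x′ < a → r x ≡ r x′ + a * t → t ≡ 0)
  → ∀ m → (P m × ¬ (a ≤ m × P (m ∸ a))) ⇔ (∃ λ x → x < a × m ≡ r x)
apery-from-normal-form {P} {a} r r+a*∈P normal unique m = mk⇔ apéry⇒ ⇒apéry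
  where
    peel : ∀ s t → s + a * suc t ≡ (s + a * t) + a
    peel s t = trans (cong (s +_) (*-suc a t)) (rotate s a (a * t))
      where
        rotate : ∀ s a p → s + (a + p) ≡ (s + p) + a
        rotate = solve-∀

    apéry⇒ : P m × ¬ (a ≤ m × P (m ∸ a)) → ∃ λ x → x < a × m ≡ r x
    apéry⇒ (m∈P , m∉a+P) with normal m∈P
    ... | x , zero , x<a , refl = x , x<a , trans (cong (r x +_) (*-zeroʳ a)) (+-identityʳ (r x))
    ... | x , suc t , x<a , refl rewrite peel (r x) t =
      ⊥-elim (m∉a+P (m≤n+m a _ , subst P (sym (m+n∸n≡m _ a)) (r+a*∈P t x<a)))

    ⇒apéry : (∃ λ x → x < a × m ≡ r x) → P m × ¬ (a ≤ m × P (m ∸ a))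
    ⇒apéry (x , x<a , refl) = subst P (trans (cong (r x +_) (*-zeroʳ a)) (+-identityʳ (r x))) (r+a*∈P 0 x<a)
                            , r∉a+P
      where
        r∉a+P : ¬ (a ≤ r x × P (r x ∸ a))
        r∉a+P (a≤r , r∸a∈P) with normal r∸a∈P
        ... | x′ , t , x′<a , eq = 1+n≢0 (unique x<a x′<a (begin
          r x                   ≡⟨ sym (m∸n+n≡m a≤r) ⟩
          r x ∸ a + a           ≡⟨ cong (_+ a) eq ⟩
          r x′ + a * t + a      ≡⟨ sym (peel (r x′) t) ⟩
          r x′ + a * suc t      ∎))
          where open ≡-Reasoning

module LucasSequence (e : ℕ) where

  -- U is defined through its positive first differences ΔU rather than by
  -- U (j + 2) = (2 + e) * U (j + 1) ∸ U j, which would involve truncated subtraction.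
  mutual
    U : ℕ → ℕ
    U zero = 0
    U (suc j) = U j + ΔU (suc j)

    ΔU : ℕ → ℕ
    ΔU zero = 1
    ΔU (suc j) = e * U j + ΔU j

  LucasLike : (ℕ → ℕ) → Set
  LucasLike w = ∀ j → w (suc (suc j)) + w j ≡ (2 + e) * w (suc j)

  U-lucasLike : LucasLike U
  U-lucasLike j = identity e (U j) (ΔU (suc j))
    where
      identity : ∀ e a c → ((a + c) + (e * (a + c) + c)) + a ≡ (2 + e) * (a + c)
      identity = solve-∀

  U-1 : U 1 ≡ 1
  U-1 = cong (_+ 1) (*-zeroʳ e)

  lucasLike-expand : ∀ w → LucasLike w → ∀ j → w (suc j) + w 0 * U j ≡ U (suc j) * w 1
  lucasLike-expand w rec zero = begin
    w 1 + w 0 * 0  ≡⟨ cong (w 1 +_) (*-zeroʳ (w 0)) ⟩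
    w 1 + 0        ≡⟨ +-identityʳ (w 1) ⟩
    w 1            ≡⟨ sym (*-identityˡ (w 1)) ⟩
    1 * w 1        ≡⟨ cong (_* w 1) (sym U-1) ⟩
    U 1 * w 1      ∎
    where open ≡-Reasoning
  lucasLike-expand w rec (suc zero) = begin
    w 2 + w 0 * U 1          ≡⟨ cong (λ u → w 2 + w 0 * u) U-1 ⟩
    w 2 + w 0 * 1            ≡⟨ cong (w 2 +_) (*-identityʳ (w 0)) ⟩
    w 2 + w 0                ≡⟨ rec 0 ⟩
    (2 + e) * w 1            ≡⟨ cong (_* w 1) (sym U-2) ⟩
    U 2 * w 1                ∎
    where
      open ≡-Reasoning
      U-2 : U 2 ≡ 2 + e
      U-2 = trans (sym (+-identityʳ (U 2))) (trans (U-lucasLike 0) (trans (cong ((2 + e) *_) U-1) (*-identityʳ (2 + e))))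
  lucasLike-expand w rec (suc (suc j)) = +-cancelʳ-≡ (w (1 + j) + w 0 * U j) _ _ (begin
    (w (3 + j) + w 0 * U (2 + j)) + (w (1 + j) + w 0 * U j)  ≡⟨ interchange (w (3 + j)) (w 0) (U (2 + j)) (w (1 + j)) (U j) ⟩
    (w (3 + j) + w (1 + j)) + w 0 * (U (2 + j) + U j)        ≡⟨ cong₂ (λ p u → p + w 0 * u) (rec (suc j)) (U-lucasLike j) ⟩
    L * w (2 + j) + w 0 * (L * U (1 + j))                    ≡⟨ factor L (w (2 + j)) (w 0) (U (1 + j)) ⟩
    L * (w (2 + j) + w 0 * U (1 + j))                        ≡⟨ cong (L *_) (lucasLike-expand w rec (suc j)) ⟩
    L * (U (2 + j) * w 1)                                    ≡⟨ sym (*-assoc L (U (2 + j)) (w 1)) ⟩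
    (L * U (2 + j)) * w 1                                    ≡⟨ cong (_* w 1) (sym (U-lucasLike (suc j))) ⟩
    (U (3 + j) + U (1 + j)) * w 1                            ≡⟨ *-distribʳ-+ (w 1) (U (3 + j)) (U (1 + j)) ⟩
    U (3 + j) * w 1 + U (1 + j) * w 1                        ≡⟨ cong (U (3 + j) * w 1 +_) (sym (lucasLike-expand w rec j)) ⟩
    U (3 + j) * w 1 + (w (1 + j) + w 0 * U j)                ∎)
    where
      open ≡-Reasoning
      L = 2 + e
      interchange : ∀ x a u y v → (x + a * u) + (y + a * v) ≡ (x + y) + a * (u + v)
      interchange = solve-∀
      factor : ∀ L x a u → L * x + a * (L * u) ≡ L * (x + a * u)
      factor = solve-∀

  ΔU-pos : ∀ j → 1 ≤ ΔU j
  ΔU-pos zero = ≤-refl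
  ΔU-pos (suc j) = ≤-trans (ΔU-pos j) (m≤n+m (ΔU j) (e * U j))

  U-<-suc : ∀ j → U j < U (suc j)
  U-<-suc j = m<m+n (U j) (ΔU-pos (suc j))

  U-pos : ∀ j → 1 ≤ U (suc j)
  U-pos j = ≤-<-trans z≤n (U-<-suc j)

  U-mono-≤ : ∀ {i j} → i ≤ j → U i ≤ U j
  U-mono-≤ i≤j = mono (≤⇒≤′ i≤j)
    where
      mono : ∀ {i j} → i ≤′ j → U i ≤ U j
      mono ≤′-refl = ≤-refl
      mono (≤′-step {j} i≤′j) = ≤-trans (mono i≤′j) (<⇒≤ (U-<-suc j))

  n≤U : ∀ n → n ≤ U n
  n≤U zero = z≤n
  n≤U (suc n) = ≤-trans (s≤s (n≤U n)) (U-<-suc n)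

  <U-suc : ∀ {x K} → x ≤ K → x < U (suc K)
  <U-suc {K = K} x≤K = ≤-trans (s≤s x≤K) (n≤U (suc K))

  top-index : ∀ {x} → 1 ≤ x → ∃ λ k → 1 ≤ k × U k ≤ x × x < U (suc k)
  top-index {x} 1≤x = search x (<U-suc ≤-refl)
    where
      search : ∀ K → x < U (suc K) → ∃ λ k → 1 ≤ k × U k ≤ x × x < U (suc k)
      search zero x<U₁ = ⊥-elim (<⇒≱ (subst (x <_) U-1 x<U₁) 1≤x)
      search (suc K) x<U with U (suc K) ≤? x
      ... | yes U≤x = suc K , s≤s z≤n , U≤x , x<U
      ... | no U≰x = search K (≰⇒> U≰x)

  greedyWith : (ℕ → ℕ) → ℕ → ℕ → ℕ
  greedyWith w r zero = 0
  greedyWith w r (suc j) = divℕ r (U (suc j)) * w (suc j) + greedyWith w (r ∸ divℕ r (U (suc j)) * U (suc j)) j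

  greedyWith-digit : ∀ w m {r} q → r < U (suc m)
                   → greedyWith w (r + q * U (suc m)) (suc m) ≡ q * w (suc m) + greedyWith w r m
  greedyWith-digit w m {r} q r<U rewrite divℕ-+-* q r<U | m+n∸n≡m r (q * U (suc m)) = refl

  greedyWith-below : ∀ w m {r} → r < U (suc m) → greedyWith w r (suc m) ≡ greedyWith w r m
  greedyWith-below w m {r} r<U = trans (cong (λ y → greedyWith w y (suc m)) (sym (+-identityʳ r))) (greedyWith-digit w m 0 r<U)

  greedyWith-+-top : ∀ w m z c → greedyWith w (z + c * U (suc m)) (suc m) ≡ c * w (suc m) + greedyWith w z (suc m)
  greedyWith-+-top w m z c with divMod-decomposition (U-pos m) z
  ... | r , q , r<U , refl = begin
    greedyWith w ((r + q * N) + c * N) (suc m)          ≡⟨ cong (λ y → greedyWith w y (suc m)) (collect r q c N) ⟩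
    greedyWith w (r + (q + c) * N) (suc m)              ≡⟨ greedyWith-digit w m (q + c) r<U ⟩
    (q + c) * w (suc m) + greedyWith w r m              ≡⟨ split q c (w (suc m)) (greedyWith w r m) ⟩
    c * w (suc m) + (q * w (suc m) + greedyWith w r m)  ≡⟨ cong (c * w (suc m) +_) (sym (greedyWith-digit w m q r<U)) ⟩
    c * w (suc m) + greedyWith w (r + q * N) (suc m)    ∎
    where
      open ≡-Reasoning
      N = U (suc m)
      collect : ∀ r q c N → (r + q * N) + c * N ≡ r + (q + c) * N
      collect = solve-∀
      split : ∀ q c x y → (q + c) * x + y ≡ c * x + (q * x + y)
      split = solve-∀

  greedyWith-+-U : ∀ w m z → greedyWith w (z + U (suc m)) (suc m) ≡ w (suc m) + greedyWith w z (suc m)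
  greedyWith-+-U w m z = begin
    greedyWith w (z + U (suc m)) (suc m)        ≡⟨ cong (λ y → greedyWith w (z + y) (suc m)) (sym (*-identityˡ (U (suc m)))) ⟩
    greedyWith w (z + 1 * U (suc m)) (suc m)    ≡⟨ greedyWith-+-top w m z 1 ⟩
    1 * w (suc m) + greedyWith w z (suc m)      ≡⟨ cong (_+ greedyWith w z (suc m)) (*-identityˡ (w (suc m))) ⟩
    w (suc m) + greedyWith w z (suc m)          ∎
    where open ≡-Reasoning

  greedyWith-0 : ∀ w m → greedyWith w 0 m ≡ 0
  greedyWith-0 w zero = refl
  greedyWith-0 w (suc m) = trans (greedyWith-digit w m 0 (U-pos m)) (greedyWith-0 w m)

  greedyWith-deeper : ∀ w {x k K} → x < U (suc k) → k ≤ K → greedyWith w x K ≡ greedyWith w x k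
  greedyWith-deeper w {x} {k} x<U k≤K = deeper (≤⇒≤′ k≤K)
    where
      deeper : ∀ {K} → k ≤′ K → greedyWith w x K ≡ greedyWith w x k
      deeper ≤′-refl = refl
      deeper (≤′-step {K} k≤′K) =
        trans (greedyWith-below w K (≤-trans x<U (U-mono-≤ (s≤s (≤′⇒≤ k≤′K))))) (deeper k≤′K)

  greedyWith-stable : ∀ w {x k K} → x < U (suc k) → x < U (suc K) → greedyWith w x K ≡ greedyWith w x k
  greedyWith-stable w {k = k} {K} x<Uₖ x<U_K with ≤-total k K
  ... | inj₁ k≤K = greedyWith-deeper w x<Uₖ k≤K
  ... | inj₂ K≤k = sym (greedyWith-deeper w x<U_K K≤k)

  greedyWith-linear : ∀ {w₁ w₂ w₃ a b} → (∀ i → w₁ (suc i) + a * w₂ (suc i) ≡ w₃ (suc i) * b)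
                    → ∀ r j → greedyWith w₁ r j + a * greedyWith w₂ r j ≡ greedyWith w₃ r j * b
  greedyWith-linear {a = a} rel r zero = *-zeroʳ a
  greedyWith-linear {w₁} {w₂} {w₃} {a} rel r (suc j) =
    linear-step a (divℕ r (U (suc j))) (rel j) (greedyWith-linear {w₁} {w₂} {w₃} {a} rel _ j)

  greedyWith-U : ∀ r m → greedyWith U r (suc m) ≡ r
  greedyWith-U r zero rewrite U-1 = trans (+-identityʳ _) (trans (*-identityʳ (r / 1)) (n/1≡n r))
  greedyWith-U r (suc m) = trans (cong (q * N +_) (greedyWith-U (r ∸ q * N) m)) (m+[n∸m]≡n (divℕ-*-≤ r N))
    where
      N = U (2 + m)
      q = divℕ r N

  lagged : ℕ → ℕ → ℕ
  lagged = greedyWith (λ i → U (pred i))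

  greedyWith-lagged : ∀ {w a W} → (∀ i → w (suc i) + a * U i ≡ U (suc i) * W)
                    → ∀ x m → greedyWith w x (suc m) + a * lagged x (suc m) ≡ x * W
  greedyWith-lagged {a = a} {W} rel x m = trans (greedyWith-linear {a = a} rel x (suc m)) (cong (_* W) (greedyWith-U x m))

  lagged-carry : ∀ m t → U m + lagged t m ≤ lagged (U m + t) m + ΔU m
  lagged-carry zero t = z≤n
  lagged-carry (suc m) t = ≤-reflexive (begin
    U (suc m) + lagged t (suc m)                   ≡⟨ rearrange (U m) (ΔU (suc m)) (lagged t (suc m)) ⟩
    (U m + lagged t (suc m)) + ΔU (suc m)          ≡⟨ cong (_+ ΔU (suc m)) (sym (greedyWith-+-U _ m t)) ⟩
    lagged (t + U (suc m)) (suc m) + ΔU (suc m)    ≡⟨ cong (λ y → lagged y (suc m) + ΔU (suc m)) (+-comm t (U (suc m))) ⟩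
    lagged (U (suc m) + t) (suc m) + ΔU (suc m)    ∎)
    where
      open ≡-Reasoning
      rearrange : ∀ u δ l → (u + δ) + l ≡ (u + l) + δ
      rearrange = solve-∀

  -- Adding ΔU (suc m) = U (suc m) - U m either keeps the top digit or carries into it;
  -- either way the lagged sum grows by at most ΔU m = U m - U (m - 1).
  mutual
    lagged-+-ΔU : ∀ m z → lagged (z + ΔU (suc m)) (suc m) ≤ lagged z (suc m) + ΔU m
    lagged-+-ΔU m z with divMod-decomposition (U-pos m) z
    ... | r , q , r<N , refl with r <? U m
    ...   | yes r<Uₘ = begin
      lagged ((r + q * N) + Δ) (suc m)      ≡⟨ cong (λ y → lagged y (suc m)) (swap r (q * N) Δ) ⟩
      lagged ((r + Δ) + q * N) (suc m)      ≡⟨ greedyWith-digit _ m q (+-monoˡ-< Δ r<Uₘ) ⟩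
      q * U m + lagged (r + Δ) m            ≤⟨ +-monoʳ-≤ (q * U m) (lagged-+-ΔU-below m r) ⟩
      q * U m + (lagged r m + ΔU m)         ≡⟨ sym (+-assoc (q * U m) (lagged r m) (ΔU m)) ⟩
      (q * U m + lagged r m) + ΔU m         ≡⟨ cong (_+ ΔU m) (sym (greedyWith-digit _ m q r<N)) ⟩
      lagged (r + q * N) (suc m) + ΔU m     ∎
      where
        open ≤-Reasoning
        N = U (suc m)
        Δ = ΔU (suc m)
        swap : ∀ r p d → (r + p) + d ≡ (r + d) + p
        swap = solve-∀
    ...   | no r≮Uₘ with m≤n⇒∃[o]m+o≡n (≮⇒≥ r≮Uₘ)
    ...     | t , refl = begin
      lagged (((U m + t) + q * N) + Δ) (suc m)     ≡⟨ cong (λ y → lagged y (suc m)) (carry (U m) t q Δ) ⟩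
      lagged (t + suc q * N) (suc m)               ≡⟨ greedyWith-digit _ m (suc q) t<N ⟩
      (U m + q * U m) + lagged t m                 ≡⟨ swap (U m) (q * U m) (lagged t m) ⟩
      q * U m + (U m + lagged t m)                 ≤⟨ +-monoʳ-≤ (q * U m) (lagged-carry m t) ⟩
      q * U m + (lagged (U m + t) m + ΔU m)        ≡⟨ sym (+-assoc (q * U m) (lagged (U m + t) m) (ΔU m)) ⟩
      (q * U m + lagged (U m + t) m) + ΔU m        ≡⟨ cong (_+ ΔU m) (sym (greedyWith-digit _ m q r<N)) ⟩
      lagged ((U m + t) + q * N) (suc m) + ΔU m    ∎
      where
        open ≤-Reasoning
        N = U (suc m)
        Δ = ΔU (suc m)
        carry : ∀ u t q d → ((u + t) + q * (u + d)) + d ≡ t + (1 + q) * (u + d)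
        carry = solve-∀
        swap : ∀ u p l → (u + p) + l ≡ p + (u + l)
        swap = solve-∀
        t<N : t < N
        t<N = ≤-trans (+-cancelˡ-< (U m) t Δ r<N) (m≤n+m Δ (U m))

    lagged-+-ΔU-below : ∀ m r → lagged (r + ΔU (suc m)) m ≤ lagged r m + ΔU m
    lagged-+-ΔU-below zero r = z≤n
    lagged-+-ΔU-below (suc m) r = begin
      lagged (r + ΔU (2 + m)) (suc m)                    ≡⟨ cong (λ y → lagged y (suc m)) (swap r (e * U (suc m)) (ΔU (suc m))) ⟩
      lagged ((r + ΔU (suc m)) + e * U (suc m)) (suc m)  ≡⟨ greedyWith-+-top _ m (r + ΔU (suc m)) e ⟩
      e * U m + lagged (r + ΔU (suc m)) (suc m)          ≤⟨ +-monoʳ-≤ (e * U m) (lagged-+-ΔU m r) ⟩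
      e * U m + (lagged r (suc m) + ΔU m)                ≡⟨ swap′ (e * U m) (lagged r (suc m)) (ΔU m) ⟩
      lagged r (suc m) + ΔU (suc m)                      ∎
      where
        open ≤-Reasoning
        swap : ∀ r p d → r + (p + d) ≡ (r + d) + p
        swap = solve-∀
        swap′ : ∀ p l d → p + (l + d) ≡ l + (p + d)
        swap′ = solve-∀

  lagged-+-U-beyond : ∀ m z → lagged (z + U (suc m)) m ≤ lagged z m + U m
  lagged-+-U-beyond zero z = z≤n
  lagged-+-U-beyond (suc m) z = begin
    lagged (z + U (2 + m)) (suc m)                           ≡⟨ cong (λ y → lagged y (suc m)) (regroup z (U (suc m)) e (ΔU (suc m))) ⟩
    lagged ((z + ΔU (suc m)) + (1 + e) * U (suc m)) (suc m)  ≡⟨ greedyWith-+-top _ m (z + ΔU (suc m)) (1 + e) ⟩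
    (1 + e) * U m + lagged (z + ΔU (suc m)) (suc m)          ≤⟨ +-monoʳ-≤ ((1 + e) * U m) (lagged-+-ΔU m z) ⟩
    (1 + e) * U m + (lagged z (suc m) + ΔU m)                ≡⟨ regroup′ (U m) e (lagged z (suc m)) (ΔU m) ⟩
    lagged z (suc m) + U (suc m)                             ∎
    where
      open ≤-Reasoning
      regroup : ∀ z u e d → z + (u + (e * u + d)) ≡ (z + d) + (1 + e) * u
      regroup = solve-∀
      regroup′ : ∀ u e l d → (1 + e) * u + (l + d) ≡ l + (u + (e * u + d))
      regroup′ = solve-∀

  lagged-+-*U-beyond : ∀ m r q → lagged (r + q * U (suc m)) m ≤ q * U m + lagged r m
  lagged-+-*U-beyond m r zero = ≤-reflexive (cong (λ y → lagged y m) (+-identityʳ r))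
  lagged-+-*U-beyond m r (suc q) = begin
    lagged (r + suc q * N) m          ≡⟨ cong (λ y → lagged y m) (peel r q N) ⟩
    lagged ((r + q * N) + N) m        ≤⟨ lagged-+-U-beyond m (r + q * N) ⟩
    lagged (r + q * N) m + U m        ≤⟨ +-monoˡ-≤ (U m) (lagged-+-*U-beyond m r q) ⟩
    (q * U m + lagged r m) + U m      ≡⟨ unpeel q (U m) (lagged r m) ⟩
    suc q * U m + lagged r m          ∎
    where
      open ≤-Reasoning
      N = U (suc m)
      peel : ∀ r q N → r + suc q * N ≡ (r + q * N) + N
      peel = solve-∀
      unpeel : ∀ q u l → (q * u + l) + u ≡ suc q * u + l
      unpeel = solve-∀

  lagged-mono : ∀ m y → lagged y m ≤ lagged y (suc m)
  lagged-mono m y with divMod-decomposition (U-pos m) y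
  ... | r , q , r<N , refl = subst (lagged (r + q * U (suc m)) m ≤_) (sym (greedyWith-digit _ m q r<N)) (lagged-+-*U-beyond m r q)

  lagged-+-U : ∀ {i K} → suc i ≤ K → ∀ z → U i + lagged z K ≤ lagged (z + U (suc i)) K
  lagged-+-U {i} i<K = go (≤⇒≤′ i<K)
    where
      go : ∀ {K} → suc i ≤′ K → ∀ z → U i + lagged z K ≤ lagged (z + U (suc i)) K
      go ≤′-refl z = ≤-reflexive (sym (greedyWith-+-U _ i z))
      go (≤′-step {K} i<′K) z with divMod-decomposition (U-pos K) z
      ... | r , q , r<N , refl = begin
        U i + lagged (r + q * N) (suc K)             ≡⟨ cong (U i +_) (greedyWith-digit _ K q r<N) ⟩
        U i + (q * U K + lagged r K)                 ≡⟨ swap (U i) (q * U K) (lagged r K) ⟩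
        q * U K + (U i + lagged r K)                 ≤⟨ +-monoʳ-≤ (q * U K) (go i<′K r) ⟩
        q * U K + lagged (r + U (suc i)) K           ≤⟨ +-monoʳ-≤ (q * U K) (lagged-mono K (r + U (suc i))) ⟩
        q * U K + lagged (r + U (suc i)) (suc K)     ≡⟨ sym (greedyWith-+-top _ K (r + U (suc i)) q) ⟩
        lagged ((r + U (suc i)) + q * N) (suc K)     ≡⟨ cong (λ y → lagged y (suc K)) (swap′ r (U (suc i)) (q * N)) ⟩
        lagged ((r + q * N) + U (suc i)) (suc K)     ∎
        where
          open ≤-Reasoning
          N = U (suc K)
          swap : ∀ u p l → u + (p + l) ≡ p + (u + l)
          swap = solve-∀
          swap′ : ∀ r u p → (r + u) + p ≡ (r + p) + u
          swap′ = solve-∀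

  lagged-+-*U : ∀ {i K} → suc i ≤ K → ∀ c z → c * U i + lagged z K ≤ lagged (z + c * U (suc i)) K
  lagged-+-*U {i} {K} i<K zero z = ≤-reflexive (cong (λ y → lagged y K) (sym (+-identityʳ z)))
  lagged-+-*U {i} {K} i<K (suc c) z = begin
    (U i + c * U i) + lagged z K                  ≡⟨ +-assoc (U i) (c * U i) (lagged z K) ⟩
    U i + (c * U i + lagged z K)                  ≤⟨ +-monoʳ-≤ (U i) (lagged-+-*U i<K c z) ⟩
    U i + lagged (z + c * U (suc i)) K            ≤⟨ lagged-+-U i<K (z + c * U (suc i)) ⟩
    lagged ((z + c * U (suc i)) + U (suc i)) K    ≡⟨ cong (λ y → lagged y K) (regroup z (c * U (suc i)) (U (suc i))) ⟩
    lagged (z + suc c * U (suc i)) K              ∎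
    where
      open ≤-Reasoning
      regroup : ∀ z p u → (z + p) + u ≡ z + (u + p)
      regroup = solve-∀

  mutual
    lagged-pred-ΔU : ∀ j {p} → suc p ≡ ΔU (suc j) → suc (lagged p j) ≡ ΔU j
    lagged-pred-ΔU zero eq = refl
    lagged-pred-ΔU (suc j) eq = lagged-pred-split j e eq

    lagged-pred-split : ∀ j c {p} → suc p ≡ c * U (suc j) + ΔU (suc j) → suc (lagged p (suc j)) ≡ c * U j + ΔU j
    lagged-pred-split j c {p} eq with m≤n⇒∃[o]m+o≡n (ΔU-pos (suc j))
    ... | p′ , 1+p′≡Δ = begin
      suc (lagged p (suc j))                    ≡⟨ cong (λ y → suc (lagged y (suc j))) p≡ ⟩
      suc (lagged (p′ + c * U (suc j)) (suc j)) ≡⟨ cong suc (greedyWith-digit _ j c p′<N) ⟩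
      suc (c * U j + lagged p′ j)               ≡⟨ sym (+-suc (c * U j) (lagged p′ j)) ⟩
      c * U j + suc (lagged p′ j)               ≡⟨ cong (c * U j +_) (lagged-pred-ΔU j 1+p′≡Δ) ⟩
      c * U j + ΔU j                            ∎
      where
        open ≡-Reasoning
        p≡ : p ≡ p′ + c * U (suc j)
        p≡ = suc-injective (trans eq (trans (cong (c * U (suc j) +_) (sym 1+p′≡Δ)) (+-comm (c * U (suc j)) (suc p′))))
        p′<N : p′ < U (suc j)
        p′<N = ≤-trans (≤-reflexive 1+p′≡Δ) (m≤n+m (ΔU (suc j)) (U j))

  lagged-pred-U : ∀ m {p} → suc p ≡ U (suc m) → U m ≤ suc (lagged p m)
  lagged-pred-U zero eq = z≤n
  lagged-pred-U (suc m) {p} eq = ≤-reflexive (sym (begin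
    suc (lagged p (suc m))          ≡⟨ lagged-pred-split m (1 + e) (trans eq (regroup (U (suc m)) e (ΔU (suc m)))) ⟩
    (1 + e) * U m + ΔU m            ≡⟨ regroup′ (U m) e (ΔU m) ⟩
    U (suc m)                       ∎))
    where
      open ≡-Reasoning
      regroup : ∀ u e d → u + (e * u + d) ≡ (1 + e) * u + d
      regroup = solve-∀
      regroup′ : ∀ u e d → (1 + e) * u + d ≡ u + (e * u + d)
      regroup′ = solve-∀

  lagged-suc : ∀ m z → lagged (suc z) m ≤ suc (lagged z m)
  lagged-suc zero z = z≤n
  lagged-suc (suc m) z with divMod-decomposition (U-pos m) z
  ... | r , q , r<N , refl with suc r <? U (suc m)
  ...   | yes 1+r<N = begin
    lagged (suc r + q * N) (suc m)    ≡⟨ greedyWith-digit _ m q 1+r<N ⟩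
    q * U m + lagged (suc r) m        ≤⟨ +-monoʳ-≤ (q * U m) (lagged-suc m r) ⟩
    q * U m + suc (lagged r m)        ≡⟨ +-suc (q * U m) (lagged r m) ⟩
    suc (q * U m + lagged r m)        ≡⟨ cong suc (sym (greedyWith-digit _ m q r<N)) ⟩
    suc (lagged (r + q * N) (suc m))  ∎
    where
      open ≤-Reasoning
      N = U (suc m)
  ...   | no 1+r≮N = begin
    lagged (suc r + q * N) (suc m)    ≡⟨ cong (λ y → lagged (y + q * N) (suc m)) 1+r≡N ⟩
    lagged (0 + suc q * N) (suc m)    ≡⟨ greedyWith-digit _ m (suc q) (U-pos m) ⟩
    suc q * U m + lagged 0 m          ≡⟨ cong (suc q * U m +_) (greedyWith-0 _ m) ⟩
    suc q * U m + 0                   ≡⟨ unpeel (U m) q ⟩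
    q * U m + U m                     ≤⟨ +-monoʳ-≤ (q * U m) (lagged-pred-U m 1+r≡N) ⟩
    q * U m + suc (lagged r m)        ≡⟨ +-suc (q * U m) (lagged r m) ⟩
    suc (q * U m + lagged r m)        ≡⟨ cong suc (sym (greedyWith-digit _ m q r<N)) ⟩
    suc (lagged (r + q * N) (suc m))  ∎
    where
      open ≤-Reasoning
      N = U (suc m)
      1+r≡N : suc r ≡ N
      1+r≡N = ≤-antisym r<N (≮⇒≥ 1+r≮N)
      unpeel : ∀ u q → suc q * u + 0 ≡ q * u + u
      unpeel = solve-∀

  lagged-+ : ∀ m z t → lagged (z + t) m ≤ lagged z m + t
  lagged-+ m z zero = ≤-reflexive (trans (cong (λ y → lagged y m) (+-identityʳ z)) (sym (+-identityʳ _)))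
  lagged-+ m z (suc t) = begin
    lagged (z + suc t) m      ≡⟨ cong (λ y → lagged y m) (+-suc z t) ⟩
    lagged (suc (z + t)) m    ≤⟨ lagged-suc m (z + t) ⟩
    suc (lagged (z + t) m)    ≤⟨ s≤s (lagged-+ m z t) ⟩
    suc (lagged z m + t)      ≡⟨ sym (+-suc (lagged z m) t) ⟩
    lagged z m + suc t        ∎
    where open ≤-Reasoning

  comb-lagged : ∀ cs i K → i + length cs ≤ K → comb (λ j → U (pred j)) (suc i) cs ≤ lagged (comb U (suc i) cs) K
  comb-lagged [] i K _ = z≤n
  comb-lagged (c ∷ cs) i K i+1+l≤K = begin
    c * U i + comb (λ j → U (pred j)) (2 + i) cs      ≤⟨ +-monoʳ-≤ (c * U i) (comb-lagged cs (suc i) K 1+i+l≤K) ⟩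
    c * U i + lagged (comb U (2 + i) cs) K            ≤⟨ lagged-+-*U i<K c (comb U (2 + i) cs) ⟩
    lagged (comb U (2 + i) cs + c * U (suc i)) K      ≡⟨ cong (λ y → lagged y K) (+-comm (comb U (2 + i) cs) (c * U (suc i))) ⟩
    lagged (c * U (suc i) + comb U (2 + i) cs) K      ∎
    where
      open ≤-Reasoning
      1+i+l≤K : suc i + length cs ≤ K
      1+i+l≤K = subst (_≤ K) (+-suc i (length cs)) i+1+l≤K
      i<K : suc i ≤ K
      i<K = ≤-trans (s≤s (m≤m+n i (length cs))) 1+i+l≤K

  comb-lagged-bound : ∀ {a W} → a ≤ W → ∀ cs {x q} → comb U 1 cs ≡ x + q * a
                    → comb (λ j → U (pred j)) 1 cs ≤ lagged x (suc (length cs + x)) + q * W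
  comb-lagged-bound {a} {W} a≤W cs {x} {q} y≡x+qa = begin
    comb (λ j → U (pred j)) 1 cs  ≤⟨ comb-lagged cs 0 K (≤-trans (m≤m+n (length cs) x) (n≤1+n _)) ⟩
    lagged (comb U 1 cs) K        ≡⟨ cong (λ y → lagged y K) y≡x+qa ⟩
    lagged (x + q * a) K          ≤⟨ lagged-+ K x (q * a) ⟩
    lagged x K + q * a            ≤⟨ +-monoʳ-≤ (lagged x K) (*-monoʳ-≤ q a≤W) ⟩
    lagged x K + q * W            ∎
    where
      open ≤-Reasoning
      K = suc (length cs + x)

  greedyWith∞ : (ℕ → ℕ) → ℕ → ℕ
  greedyWith∞ w x = greedyWith w x (suc x)

  greedyWith∞-top : ∀ w {x} k → x < U (suc k) → greedyWith∞ w x ≡ greedyWith w x k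
  greedyWith∞-top w {x} k x<U = greedyWith-stable w {x} {k} {suc x} x<U (<U-suc (n≤1+n x))

  comb-normal-form : ∀ {w a W} → (∀ i → w (suc i) + a * U i ≡ U (suc i) * W) → 1 ≤ a → a ≤ W
                   → ∀ cs → ∃₂ λ x t → x < a × comb w 1 cs ≡ greedyWith∞ w x + a * t
  comb-normal-form {w} {a} {W} rel 1≤a a≤W cs with divMod-decomposition 1≤a (comb U 1 cs)
  ... | x , q , x<a , y≡x+qa with m≤n⇒∃[o]m+o≡n (comb-lagged-bound a≤W cs {x} {q} y≡x+qa)
  ... | δ , σ+δ≡h+qW = x , δ , x<a , +-cancelʳ-≡ (a * σ) _ _ (begin
    C + a * σ                          ≡⟨ comb-linear {a = a} rel 0 cs ⟩
    comb U 1 cs * W                    ≡⟨ cong (_* W) y≡x+qa ⟩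
    (x + q * a) * W                    ≡⟨ expand x q a W ⟩
    x * W + a * (q * W)                ≡⟨ cong (_+ a * (q * W)) (sym (greedyWith-lagged {a = a} rel x (length cs + x))) ⟩
    (g + a * h) + a * (q * W)          ≡⟨ collect g a h (q * W) ⟩
    g + a * (h + q * W)                ≡⟨ cong (λ y → g + a * y) (sym σ+δ≡h+qW) ⟩
    g + a * (σ + δ)                    ≡⟨ split g a σ δ ⟩
    (g + a * δ) + a * σ                ≡⟨ cong (λ y → (y + a * δ) + a * σ) g≡greedyWith∞ ⟩
    (greedyWith∞ w x + a * δ) + a * σ  ∎)
    where
      open ≡-Reasoning
      K = suc (length cs + x)
      C = comb w 1 cs
      σ = comb (λ j → U (pred j)) 1 cs
      g = greedyWith w x K
      g≡greedyWith∞ : g ≡ greedyWith∞ w x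
      g≡greedyWith∞ = greedyWith-stable w {x} {suc x} {K} (<U-suc (n≤1+n x))
                        (<U-suc (≤-trans (m≤n+m x (length cs)) (n≤1+n (length cs + x))))
      h = lagged x K
      expand : ∀ x q a W → (x + q * a) * W ≡ x * W + a * (q * W)
      expand = solve-∀
      collect : ∀ g a h p → (g + a * h) + a * p ≡ g + a * (h + p)
      collect = solve-∀
      split : ∀ g a s d → g + a * (s + d) ≡ (g + a * d) + a * s
      split = solve-∀

  greedyWith∞-unique : ∀ {w a W} → (∀ i → w (suc i) + a * U i ≡ U (suc i) * W) → 1 ≤ a → Coprime a W
                     → ∀ {x x′ t} → x < a → x′ < a → greedyWith∞ w x ≡ greedyWith∞ w x′ + a * t → t ≡ 0
  greedyWith∞-unique {w} {a} {W} rel 1≤a cop {x} {x′} {t} x<a x′<a eq =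
    m*n≡0⇒m≡0 t a {{>-nonZero 1≤a}} (trans (*-comm t a) (sym (+-cancelˡ-≡ g 0 (a * t) (trans (+-identityʳ g) eq′))))
    where
      open ≡-Reasoning
      g = greedyWith∞ w x
      h = lagged x (suc x)
      g′ = greedyWith∞ w x′
      h′ = lagged x′ (suc x′)
      regroup : ∀ g a t h h′ → ((g + a * t) + a * h) + a * h′ ≡ (g + a * h′) + a * (t + h)
      regroup = solve-∀
      x≡x′ : x ≡ x′
      x≡x′ = coprime-cancel cop x<a x′<a (begin
        x * W + a * h′                   ≡⟨ cong (_+ a * h′) (sym (greedyWith-lagged {a = a} rel x x)) ⟩
        (g + a * h) + a * h′             ≡⟨ cong (λ y → (y + a * h) + a * h′) eq ⟩
        ((g′ + a * t) + a * h) + a * h′  ≡⟨ regroup g′ a t h h′ ⟩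
        (g′ + a * h′) + a * (t + h)      ≡⟨ cong (_+ a * (t + h)) (greedyWith-lagged {a = a} rel x′ x′) ⟩
        x′ * W + a * (t + h)             ∎)
      eq′ : g ≡ g + a * t
      eq′ = subst (λ y → g ≡ greedyWith∞ w y + a * t) (sym x≡x′) eq

module Generated (V : ℕ → ℕ) (n d : ℕ) where

  private
    _⊕_ : List ℕ → List ℕ → List ℕ
    [] ⊕ ys = ys
    (x ∷ xs) ⊕ [] = x ∷ xs
    (x ∷ xs) ⊕ (y ∷ ys) = (x + y) ∷ (xs ⊕ ys)

    combFrom-⊕ : ∀ i xs ys → combFrom V n d i (xs ⊕ ys) ≡ combFrom V n d i xs + combFrom V n d i ys
    combFrom-⊕ i [] ys = refl
    combFrom-⊕ i (x ∷ xs) [] = sym (+-identityʳ _)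
    combFrom-⊕ i (x ∷ xs) (y ∷ ys) =
      trans (cong ((x + y) * V (n + i * d) +_) (combFrom-⊕ (suc i) xs ys)) (interchange x y (V (n + i * d)) _ _)
      where
        interchange : ∀ x y v p q → (x + y) * v + (p + q) ≡ (x * v + p) + (y * v + q)
        interchange = solve-∀

    combFrom-single : ∀ j c i → combFrom V n d i (replicate j 0 ++ c ∷ []) ≡ c * V (n + (j + i) * d)
    combFrom-single zero c i = +-identityʳ _
    combFrom-single (suc j) c i = trans (combFrom-single j c (suc i)) (cong (λ k → c * V (n + k * d)) (+-suc j i))

  InS-+ : ∀ {x y} → InS V n d x → InS V n d y → InS V n d (x + y)
  InS-+ (xs , refl) (ys , refl) = xs ⊕ ys , sym (combFrom-⊕ 0 xs ys)

  InS-generator : ∀ j c → InS V n d (c * V (n + j * d))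
  InS-generator j c = replicate j 0 ++ c ∷ [] , sym (trans (combFrom-single j c 0) (cong (λ k → c * V (n + k * d)) (+-identityʳ j)))

  InS-greedy : ∀ r j → InS V n d (greedy V n d r j)
  InS-greedy r zero = [] , refl
  InS-greedy r (suc j) = InS-+ (InS-generator (suc j) (divℕ r (G d (suc j)))) (InS-greedy _ j)

module EvenStep (m : ℕ) where

  d : ℕ
  d = 2 + m * 2

  e : ℕ
  e = lucas d ∸ 2

  open LucasSequence e public

  lucas≡2+e : lucas d ≡ 2 + e
  lucas≡2+e = sym (m+[n∸m]≡n (+-mono-≤ (F-pos (m * 2)) (F-pos (2 + m * 2))))

  fibonacciLike-every-d : ∀ Y → FibonacciLike Y → ∀ c → LucasLike (λ j → Y (c + j * d))
  fibonacciLike-every-d Y rec c j = begin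
    Y (c + (2 + j) * d) + Y (c + j * d)   ≡⟨ cong (λ i → Y i + Y (c + j * d)) (reindex₂ c d (j * d)) ⟩
    Y ((d + d) + (c + j * d)) + Y (c + j * d)
                                          ≡⟨ lucas-doubling (λ t → Y (t + (c + j * d))) (fibonacciLike-shift Y rec (c + j * d)) m ⟩
    lucas d * Y (d + (c + j * d))         ≡⟨ cong₂ _*_ lucas≡2+e (cong Y (reindex₁ c d (j * d))) ⟩
    (2 + e) * Y (c + (1 + j) * d)         ∎
    where
      open ≡-Reasoning
      reindex₂ : ∀ c d p → c + (d + (d + p)) ≡ (d + d) + (c + p)
      reindex₂ = solve-∀
      reindex₁ : ∀ c d p → d + (c + p) ≡ c + (d + p)
      reindex₁ = solve-∀

  F-*d : ∀ j → F (j * d) ≡ U j * F d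
  F-*d zero = refl
  F-*d (suc j) = trans (sym (+-identityʳ _))
    (trans (lucasLike-expand (λ j → F (j * d)) (fibonacciLike-every-d F (λ _ → refl) 0) j)
           (cong (λ i → U (suc j) * F i) (+-identityʳ d)))

  G≡U : ∀ j → G d j ≡ U j
  G≡U j = trans (cong (λ y → divℕ y (F d)) (F-*d j)) (divℕ-+-* (U j) (F-pos (suc (m * 2))))

private
  <⇒≤∸1 : ∀ {y a} → y < a → y ≤ a ∸ 1
  <⇒≤∸1 {a = suc a} (s≤s y≤a) = y≤a

  ≤∸1⇒< : ∀ {y a} → 1 ≤ a → y ≤ a ∸ 1 → y < a
  ≤∸1⇒< {a = suc a} _ y≤a = s≤s y≤a

module Apéry (V : ℕ → ℕ) (Vrec : FibonacciLike (λ t → V (suc t))) (n′ m : ℕ) where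

  open EvenStep m

  n : ℕ
  n = suc n′

  open Generated V n d

  a W : ℕ
  a = V n
  W = V (n + 1 * d)

  w : ℕ → ℕ
  w j = V (n + j * d)

  w-expand : ∀ i → w (suc i) + a * U i ≡ U (suc i) * W
  w-expand i = subst (λ v → w (suc i) + v * U i ≡ U (suc i) * W) (cong V (+-identityʳ n))
                     (lucasLike-expand w (fibonacciLike-every-d (λ t → V (suc t)) Vrec n′) i)

  W-expand : W ≡ F (suc (m * 2)) * a + F d * V (suc n)
  W-expand = trans (cong (λ i → V (suc i)) (reindex n′ d))
    (fibonacciLike-expand (λ t → V (suc (t + n′))) (fibonacciLike-shift (λ t → V (suc t)) Vrec n′) (suc (m * 2)))
    where
      reindex : ∀ n d → n + (d + 0) ≡ d + n
      reindex = solve-∀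

  a≤W : a ≤ W
  a≤W = subst (a ≤_) (sym W-expand)
    (≤-trans (m≤n*m a (F (suc (m * 2))) {{>-nonZero (F-pos (m * 2))}}) (m≤m+n _ (F d * V (suc n))))

  a⊥W : Coprime (V 1) (V 2) → Coprime a (F d) → Coprime a W
  a⊥W V₁⊥V₂ a⊥F {i} (i∣a , i∣W) = fibonacciLike-coprime (λ t → V (suc t)) Vrec V₁⊥V₂ n′ (i∣a , i∣Vₙ₊₁)
    where
      i⊥F : Coprime i (F d)
      i⊥F (j∣i , j∣F) = a⊥F (∣-trans j∣i i∣a , j∣F)
      i∣Vₙ₊₁ : i ∣ V (suc n)
      i∣Vₙ₊₁ = coprime-divisor i⊥F
        (∣m+n∣m⇒∣n (subst (i ∣_) W-expand i∣W) (∣-trans i∣a (n∣m*n (F (suc (m * 2))))))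

  greedy≡greedyWith : ∀ r j → greedy V n d r j ≡ greedyWith w r j
  greedy≡greedyWith r zero = refl
  greedy≡greedyWith r (suc j) rewrite G≡U (suc j) = cong (divℕ r (U (suc j)) * w (suc j) +_) (greedy≡greedyWith _ j)

  combFrom≡comb : ∀ i cs → combFrom V n d i cs ≡ comb w i cs
  combFrom≡comb i [] = refl
  combFrom≡comb i (c ∷ cs) = cong (c * w i +_) (combFrom≡comb (suc i) cs)

  InS-normal-form : 1 ≤ a → ∀ {x} → InS V n d x → ∃₂ λ y t → y < a × x ≡ greedyWith∞ w y + a * t
  InS-normal-form 1≤a ([] , refl) = 0 , 0 , 1≤a , sym (trans (cong (_+ a * 0) (greedyWith-0 w 1)) (*-zeroʳ a))
  InS-normal-form 1≤a (c ∷ cs , refl) with comb-normal-form w-expand 1≤a a≤W cs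
  ... | y , t , y<a , eq = y , c + t , y<a , (begin
    c * V (n + 0) + combFrom V n d 1 cs  ≡⟨ cong₂ (λ v z → c * v + z) (cong V (+-identityʳ n)) (combFrom≡comb 1 cs) ⟩
    c * a + comb w 1 cs                  ≡⟨ cong (c * a +_) eq ⟩
    c * a + (greedyWith∞ w y + a * t)    ≡⟨ collect c a (greedyWith∞ w y) t ⟩
    greedyWith∞ w y + a * (c + t)        ∎)
    where
      open ≡-Reasoning
      collect : ∀ c a g t → c * a + (g + a * t) ≡ g + a * (c + t)
      collect = solve-∀

  InS-greedyWith∞ : ∀ y t → InS V n d (greedyWith∞ w y + a * t)
  InS-greedyWith∞ y t = InS-+ (subst (InS V n d) (greedy≡greedyWith y (suc y)) (InS-greedy y (suc y)))
                              (subst (InS V n d) (trans (cong (λ i → t * V i) (+-identityʳ n)) (*-comm t a)) (InS-generator 0 t))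

  apéry-normal-form : 1 ≤ a → Coprime a W → ∀ x → InAp V n d a x ⇔ (∃ λ y → y < a × x ≡ greedyWith∞ w y)
  apéry-normal-form 1≤a a⊥W = apery-from-normal-form (greedyWith∞ w) (λ {y} t _ → InS-greedyWith∞ y t)
    (InS-normal-form 1≤a) (greedyWith∞-unique w-expand 1≤a a⊥W)

  normal-form⇔s : 1 ≤ a → ∀ x → (∃ λ y → y < a × x ≡ greedyWith∞ w y)
                ⇔ (x ≡ 0 ⊎ ∃ λ y → ∃ λ k → 1 ≤ y × y ≤ a ∸ 1 × IsTopIndex d y k × x ≡ s V n d y k)
  normal-form⇔s 1≤a x = mk⇔ to from
    where
      to : (∃ λ y → y < a × x ≡ greedyWith∞ w y)
         → x ≡ 0 ⊎ ∃ λ y → ∃ λ k → 1 ≤ y × y ≤ a ∸ 1 × IsTopIndex d y k × x ≡ s V n d y k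
      to (zero , _ , refl) = inj₁ (greedyWith-0 w 1)
      to (y@(suc _) , y<a , refl) with top-index (s≤s z≤n)
      ... | k , 1≤k , Uₖ≤y , y<Uₖ₊₁ =
        inj₂ (y , k , s≤s z≤n , <⇒≤∸1 y<a
             , (1≤k , subst (_≤ y) (sym (G≡U k)) Uₖ≤y , subst (y <_) (sym (G≡U (suc k))) y<Uₖ₊₁)
             , trans (greedyWith∞-top w k y<Uₖ₊₁) (sym (greedy≡greedyWith y k)))
      from : x ≡ 0 ⊎ (∃ λ y → ∃ λ k → 1 ≤ y × y ≤ a ∸ 1 × IsTopIndex d y k × x ≡ s V n d y k)
           → ∃ λ y → y < a × x ≡ greedyWith∞ w y
      from (inj₁ refl) = 0 , 1≤a , sym (greedyWith-0 w 1)
      from (inj₂ (y , k , _ , y≤a∸1 , (_ , _ , y<G) , refl)) =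
        y , ≤∸1⇒< 1≤a y≤a∸1 , trans (greedy≡greedyWith y k) (sym (greedyWith∞-top w k (subst (y <_) (G≡U (suc k)) y<G)))

theorem3p3p3 : (V : ℕ → ℕ) → (∀ j → 1 ≤ j → 1 ≤ V j)
    → (∀ j → V (suc (suc (suc j))) ≡ V (suc (suc j)) + V (suc j))
    → (n d : ℕ) → 1 ≤ n → 2 ≤ d → 2 ∣ d
    → gcd (V 1) (V 2) ≡ 1 → gcd (V n) (F d) ≡ 1
    → ∀ m → InAp V n d (V n) m
      ⇔ (m ≡ 0 ⊎ ∃ λ x → ∃ λ k → 1 ≤ x × x ≤ V n ∸ 1 × IsTopIndex d x k × m ≡ s V n d x k)
theorem3p3p3 V Vpos Vrec zero _ () _ _ _ _ _
theorem3p3p3 V Vpos Vrec (suc n′) _ _ () (divides zero refl) _ _ _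
theorem3p3p3 V Vpos Vrec (suc n′) _ 1≤n 2≤d (divides (suc m) refl) gcd-V₁V₂ gcd-VₙF x =
  ⇔-trans (apéry-normal-form 1≤a (a⊥W (gcd≡1⇒coprime gcd-V₁V₂) (gcd≡1⇒coprime gcd-VₙF)) x) (normal-form⇔s 1≤a x)
  where
    open Apéry V Vrec n′ m
    1≤a : 1 ≤ a
    1≤a = Vpos n 1≤n
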